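{- Let $S=(S_i)_{i\in\mathbb{Z}}$ be an extraTrib. Then there is a unique Tribonacci-like sequence $Q=(Q_i)_{i\in\mathbb Z}$ (with rational terms) whose difference sequence is $S$, i.e. $Q_{i+1}-Q_i=S_i$ for all $i$. This $Q$ is an extraTrib if and only if $S$ is not of type EEOO.
   Context: A Tribonacci-like sequence is a two-sided sequence $(X_i)_{i\in\mathbb Z}$ satisfying $X_i=X_{i-1}+X_{i-2}+X_{i-3}$ for all $i$. An extraTrib is a Tribonacci-like sequence of integers whose terms are positive for all sufficiently large indices. The difference sequence of $X$ is $D_i=X_{i+1}-X_i$. Every Tribonacci-like integer sequence has one of four parity patterns: all terms even (EEEE), all odd (OOOO), alternating even/odd (EOEO), or periodically two even terms followed by two odd terms (EEOO). -}

module Defs where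

open import Data.Integer using (ℤ; +_; _+_; _-_; _*_; _>_; _≤_)
open import Data.Integer.Divisibility using (_∣_)
import Data.Rational as ℚ
open ℚ using (ℚ)

_/1 : ℤ → ℚ
x /1 = x ℚ./ 1
open import Data.Product using (Σ; ∃; _×_)
open import Relation.Binary.PropositionalEquality using (_≡_)
open import Relation.Nullary using (¬_)

TribLike : (ℤ → ℤ) → Set
TribLike X = ∀ i → X i ≡ X (i - + 1) + X (i - + 2) + X (i - + 3)

TribLikeℚ : (ℤ → ℚ) → Set
TribLikeℚ X = ∀ i → X i ≡ (X (i - + 1) ℚ.+ X (i - + 2)) ℚ.+ X (i - + 3)

EventuallyPositive : (ℤ → ℤ) → Set
EventuallyPositive X = ∃ λ N → ∀ i → N ≤ i → X i > + 0

ExtraTrib : (ℤ → ℤ) → Set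
ExtraTrib X = TribLike X × EventuallyPositive X

ExtraTribℚ : (ℤ → ℚ) → Set
ExtraTribℚ Q = ∃ λ (X : ℤ → ℤ) → (∀ i → Q i ≡ X i /1) × ExtraTrib X

HasDifference : (ℤ → ℚ) → (ℤ → ℤ) → Set
HasDifference Q S = ∀ i → Q (i + + 1) ℚ.- Q i ≡ S i /1

Even Odd : ℤ → Set
Even x = + 2 ∣ x
Odd x = ¬ (+ 2 ∣ x)

TypeEEOO : (ℤ → ℤ) → Set
TypeEEOO S = ∃ λ j → ∀ i →
  Even (S (j + + 4 * i)) × Even (S (j + + 4 * i + + 1))
  × Odd (S (j + + 4 * i + + 2)) × Odd (S (j + + 4 * i + + 3))

-- From Q (i+3) = Q (i+2) + Q (i+1) + Q i and Q (i+1) - Q i = S i one reads off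
-- 2 Q i = S (i+2) - S i, so the antiderivative is forced, and conversely this Q is
-- Tribonacci-like with difference S. Hence Q is an integer sequence iff every
-- S (i+2) - S i is even, and then Q i = (S (i+1) + S (i-1)) / 2 is eventually positive.
-- Consecutive differences S (i+3) - S (i+1) and S (i+2) - S i differ by 2 S i, so these
-- two-step differences are either all even or all odd. All odd means S (i+2) and S i
-- always have opposite parity, which forces the pattern EEOO; conversely EEOO has an
-- even S j with S (j+2) odd.

module Submission where

open import Defs
import Data.Nat as ℕ
import Data.Nat.Coprimality as Coprime
import Data.Nat.Properties as ℕ
open import Data.Integer as ℤ using (ℤ; +_; -[1+_]; _+_; _-_; _*_; -_; _≤_; _<_)
import Data.Integer.Properties as ℤ
open import Data.Integer.Divisibility.Signed
  using (_∣_; divides; _∣?_; ∣ᵤ⇒∣; ∣⇒∣ᵤ; ∣m∣n⇒∣m+n; ∣m∣n⇒∣m-n; ∣m⇒∣-m)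
open import Data.Integer.DivMod using (_/_; _%_; a≡a%n+[a/n]*n; n%d<d)
open import Data.Integer.Tactic.RingSolver using (solve-∀)
open import Data.Rational as ℚ using (ℚ; mkℚ; ½)
import Data.Rational.Properties as ℚ
import Data.Rational.Solver as ℚSolver
open import Algebra.Properties.CommutativeSemigroup ℤ.+-commutativeSemigroup using (xy∙z≈xz∙y)
open import Data.Product using (∃; _×_; _,_)
open import Data.Sum using (_⊎_; inj₁; inj₂)
open import Data.Empty using (⊥-elim)
open import Function using (_∘_)
open import Relation.Nullary using (¬_; yes; no)
open import Relation.Binary.PropositionalEquality
open import Function.Bundles using (_⇔_; mk⇔)

open ≡-Reasoning

-- _/1 normalises through a gcd and so does not compute on variables; fromℤ does.
fromℤ : ℤ → ℚ
fromℤ x = mkℚ x 0 (Coprime.sym (Coprime.1-coprimeTo ℤ.∣ x ∣))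

/1≡fromℤ : ∀ x → x /1 ≡ fromℤ x
/1≡fromℤ x = ℚ.↥p/↧p≡p (fromℤ x)

/1-+ : ∀ x y → (x + y) /1 ≡ x /1 ℚ.+ y /1
/1-+ x y rewrite /1≡fromℤ x | /1≡fromℤ y =
  cong _/1 (cong₂ _+_ (sym (ℤ.*-identityʳ x)) (sym (ℤ.*-identityʳ y)))

/1-neg : ∀ x → (- x) /1 ≡ ℚ.- (x /1)
/1-neg x rewrite /1≡fromℤ x | /1≡fromℤ (- x) = fromℤ-neg x
  where
  fromℤ-neg : ∀ x → fromℤ (- x) ≡ ℚ.- fromℤ x
  fromℤ-neg (+ 0)       = refl
  fromℤ-neg (+ ℕ.suc n) = refl
  fromℤ-neg -[1+ n ]    = refl

/1-minus : ∀ x y → (x - y) /1 ≡ x /1 ℚ.- y /1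
/1-minus x y = trans (/1-+ x (- y)) (cong (x /1 ℚ.+_) (/1-neg y))

/1-injective : ∀ {x y} → x /1 ≡ y /1 → x ≡ y
/1-injective {x} {y} eq = cong ℚ.↥_ (trans (sym (/1≡fromℤ x)) (trans eq (/1≡fromℤ y)))

½*[p+p]≡p : ∀ p → ½ ℚ.* (p ℚ.+ p) ≡ p
½*[p+p]≡p p = trans (regroup ½ p) (ℚ.*-identityˡ p)
  where
  open ℚSolver.+-*-Solver
  regroup : ∀ h p → h ℚ.* (p ℚ.+ p) ≡ (h ℚ.+ h) ℚ.* p
  regroup = solve 2 (λ h p → h :* (p :+ p) := (h :+ h) :* p) refl

p+p≡q+q⇒p≡q : ∀ {p q} → p ℚ.+ p ≡ q ℚ.+ q → p ≡ q
p+p≡q+q⇒p≡q {p} {q} eq = begin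
  p                  ≡⟨ ½*[p+p]≡p p ⟨
  ½ ℚ.* (p ℚ.+ p)    ≡⟨ cong (½ ℚ.*_) eq ⟩
  ½ ℚ.* (q ℚ.+ q)    ≡⟨ ½*[p+p]≡p q ⟩
  q                  ∎

odd⇒2q+1 : ∀ {x} → ¬ + 2 ∣ x → ∃ λ q → x ≡ q * + 2 + + 1
odd⇒2q+1 {x} odd with x % + 2 | n%d<d x (+ 2) | a≡a%n+[a/n]*n x (+ 2)
... | 0 | _ | eq = ⊥-elim (odd (divides (x / + 2) (trans eq (ℤ.+-identityˡ _))))
... | 1 | _ | eq = x / + 2 , trans eq (ℤ.+-comm (+ 1) ((x / + 2) * + 2))
... | ℕ.suc (ℕ.suc _) | ℕ.s≤s (ℕ.s≤s ()) | _

odd+odd⇒even : ∀ {x y} → ¬ + 2 ∣ x → ¬ + 2 ∣ y → + 2 ∣ x + y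
odd+odd⇒even {x} {y} ox oy with odd⇒2q+1 ox | odd⇒2q+1 oy
... | q , x≡2q+1 | r , y≡2r+1 = divides (q + r + + 1) (begin
  x + y                               ≡⟨ cong₂ _+_ x≡2q+1 y≡2r+1 ⟩
  (q * + 2 + + 1) + (r * + 2 + + 1)   ≡⟨ sum-of-odds q r ⟩
  (q + r + + 1) * + 2                 ∎)
  where
  sum-of-odds : ∀ q r → (q * + 2 + + 1) + (r * + 2 + + 1) ≡ (q + r + + 1) * + 2
  sum-of-odds = solve-∀

2∣x+x : ∀ x → + 2 ∣ x + x
2∣x+x x = divides x (x+x≡x*2 x)
  where
  x+x≡x*2 : ∀ x → x + x ≡ x * + 2
  x+x≡x*2 = solve-∀

infix 4 _≡₂_

-- A record rather than a function, so that x and y can be inferred from x ≡₂ y.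
record _≡₂_ (x y : ℤ) : Set where
  constructor mod2
  field 2∣x-y : + 2 ∣ x - y

x-y+y≡x : ∀ x y → x - y + y ≡ x
x-y+y≡x = solve-∀

≡₂-refl : ∀ {x} → x ≡₂ x
≡₂-refl {x} = mod2 (subst (+ 2 ∣_) (sym (ℤ.+-inverseʳ x)) (divides (+ 0) refl))

≡₂-sym : ∀ {x y} → x ≡₂ y → y ≡₂ x
≡₂-sym {x} {y} (mod2 p) = mod2 (subst (+ 2 ∣_) (neg-minus x y) (∣m⇒∣-m p))
  where
  neg-minus : ∀ x y → - (x - y) ≡ y - x
  neg-minus = solve-∀

≡₂-trans : ∀ {x y z} → x ≡₂ y → y ≡₂ z → x ≡₂ z
≡₂-trans {x} {y} {z} (mod2 p) (mod2 q) =
  mod2 (subst (+ 2 ∣_) (ℤ.+-minus-telescope x y z) (∣m∣n⇒∣m+n p q))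

even-resp-≡₂ : ∀ {x y} → x ≡₂ y → + 2 ∣ y → + 2 ∣ x
even-resp-≡₂ {x} {y} (mod2 p) e = subst (+ 2 ∣_) (x-y+y≡x x y) (∣m∣n⇒∣m+n p e)

odd-resp-≡₂ : ∀ {x y} → x ≡₂ y → ¬ + 2 ∣ y → ¬ + 2 ∣ x
odd-resp-≡₂ p o e = o (even-resp-≡₂ (≡₂-sym p) e)

≢₂-even⇒odd : ∀ {x y} → ¬ x ≡₂ y → + 2 ∣ y → ¬ + 2 ∣ x
≢₂-even⇒odd p e ex = p (mod2 (∣m∣n⇒∣m-n ex e))

≢₂-odd⇒even : ∀ {x y} → ¬ x ≡₂ y → ¬ + 2 ∣ y → + 2 ∣ x
≢₂-odd⇒even {x} {y} p o = subst (+ 2 ∣_) (x-y+y≡x x y) (odd+odd⇒even (p ∘ mod2) o)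

≢₂-trans : ∀ {x y z} → ¬ x ≡₂ y → ¬ y ≡₂ z → x ≡₂ z
≢₂-trans {x} {y} {z} p q =
  mod2 (subst (+ 2 ∣_) (ℤ.+-minus-telescope x y z) (odd+odd⇒even (p ∘ mod2) (q ∘ mod2)))

ℤ-induction : (P : ℤ → Set) → P (+ 0) →
              (∀ k → P k → P (k + + 1)) → (∀ k → P (k + + 1) → P k) → ∀ i → P i
ℤ-induction P p₀ up down (+ n)    = nonNeg n
  where
  nonNeg : ∀ n → P (+ n)
  nonNeg ℕ.zero    = p₀
  nonNeg (ℕ.suc n) = subst P (cong +_ (ℕ.+-comm n 1)) (up (+ n) (nonNeg n))
ℤ-induction P p₀ up down -[1+ n ] = neg n
  where
  neg : ∀ n → P -[1+ n ]
  neg ℕ.zero    = down -[1+ 0 ] p₀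
  neg (ℕ.suc n) = down -[1+ ℕ.suc n ] (neg n)

≡₂-constant : (f : ℤ → ℤ) → (∀ i → f (i + + 1) ≡₂ f i) → ∀ i → f i ≡₂ f (+ 0)
≡₂-constant f step = ℤ-induction (λ i → f i ≡₂ f (+ 0)) ≡₂-refl
  (λ k p → ≡₂-trans (step k) p) (λ k p → ≡₂-trans (≡₂-sym (step k)) p)

TribonacciBy : {A : Set} → (A → A → A) → (ℤ → A) → Set
TribonacciBy _⊕_ X = ∀ i → X i ≡ (X (i - + 1) ⊕ X (i - + 2)) ⊕ X (i - + 3)

module _ {A : Set} (_⊕_ : A → A → A) where

  tribonacciBy-forward : ∀ {X} → TribonacciBy _⊕_ X →
                         ∀ i → X (i + + 3) ≡ (X (i + + 2) ⊕ X (i + + 1)) ⊕ X i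
  tribonacciBy-forward {X} t i = trans (t (i + + 3))
    (cong₂ _⊕_ (cong₂ _⊕_ (reindex 1) (reindex 2)) (trans (reindex 3) (cong X (ℤ.+-identityʳ i))))
    where
    reindex : ∀ k → X (i + + 3 - + k) ≡ X (i + (+ 3 - + k))
    reindex k = cong X (ℤ.+-assoc i (+ 3) (- + k))

  tribonacciBy-shift : ∀ {X} → TribonacciBy _⊕_ X → ∀ n → TribonacciBy _⊕_ (λ i → X (i + n))
  tribonacciBy-shift {X} t n i = trans (t (i + n))
    (cong₂ _⊕_ (cong₂ _⊕_ (commute 1) (commute 2)) (commute 3))
    where
    commute : ∀ k → X (i + n - + k) ≡ X (i - + k + n)
    commute k = cong X (xy∙z≈xz∙y i n (- + k))

  tribonacciBy-map : ∀ {B : Set} (_⊛_ : B → B → B) {X} (f : A → B) →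
                     (∀ a b → f (a ⊕ b) ≡ f a ⊛ f b) →
                     TribonacciBy _⊕_ X → TribonacciBy _⊛_ (f ∘ X)
  tribonacciBy-map _⊛_ f hom t i =
    trans (cong f (t i)) (trans (hom _ _) (cong (_⊛ _) (hom _ _)))

  tribonacciBy-reflect : ∀ {B : Set} (_⊛_ : B → B → B) {X Y} (f : A → B) →
                         (∀ {a b} → f a ≡ f b → a ≡ b) → (∀ a b → f (a ⊕ b) ≡ f a ⊛ f b) →
                         (∀ i → f (X i) ≡ Y i) → TribonacciBy _⊛_ Y → TribonacciBy _⊕_ X
  tribonacciBy-reflect _⊛_ {X} {Y} f injective hom fX≡Y t i = injective (begin
    f (X i)
      ≡⟨ fX≡Y i ⟩
    Y i
      ≡⟨ t i ⟩
    (Y (i - + 1) ⊛ Y (i - + 2)) ⊛ Y (i - + 3)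
      ≡⟨ cong₂ _⊛_ (cong₂ _⊛_ (fX≡Y _) (fX≡Y _)) (fX≡Y _) ⟨
    (f (X (i - + 1)) ⊛ f (X (i - + 2))) ⊛ f (X (i - + 3))
      ≡⟨ cong (_⊛ _) (hom _ _) ⟨
    f (X (i - + 1) ⊕ X (i - + 2)) ⊛ f (X (i - + 3))
      ≡⟨ hom _ _ ⟨
    f ((X (i - + 1) ⊕ X (i - + 2)) ⊕ X (i - + 3))
      ∎)

tribLike-- : ∀ {X Y} → TribLike X → TribLike Y → TribLike (λ i → X i - Y i)
tribLike-- {X} {Y} tx ty i = trans (cong₂ _-_ (tx i) (ty i))
  (regroup (X (i - + 1)) (X (i - + 2)) (X (i - + 3)) (Y (i - + 1)) (Y (i - + 2)) (Y (i - + 3)))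
  where
  regroup : ∀ a b c d e f → (a + b + c) - (d + e + f) ≡ (a - d) + (b - e) + (c - f)
  regroup = solve-∀

twoStepDiff : (ℤ → ℤ) → ℤ → ℤ
twoStepDiff S i = S (i + + 2) - S i

module _ {S : ℤ → ℤ} (tr : TribLike S) where

  twoStepDiff-tribLike : TribLike (twoStepDiff S)
  twoStepDiff-tribLike = tribLike-- (tribonacciBy-shift _+_ tr (+ 2)) tr

  twoStepDiff-suc≡outer : ∀ i → twoStepDiff S (i + + 1) ≡ S (i + + 2) + S i
  twoStepDiff-suc≡outer i = begin
    S (i + + 1 + + 2) - S (i + + 1)
      ≡⟨ cong (λ j → S j - S (i + + 1)) (ℤ.+-assoc i (+ 1) (+ 2)) ⟩
    S (i + + 3) - S (i + + 1)
      ≡⟨ cong (_- S (i + + 1)) (tribonacciBy-forward _+_ tr i) ⟩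
    (S (i + + 2) + S (i + + 1) + S i) - S (i + + 1)
      ≡⟨ cancel (S (i + + 2)) (S (i + + 1)) (S i) ⟩
    S (i + + 2) + S i
      ∎
    where
    cancel : ∀ a b c → (a + b + c) - b ≡ a + c
    cancel = solve-∀

  twoStepDiff-suc : ∀ i → twoStepDiff S (i + + 1) ≡ twoStepDiff S i + (S i + S i)
  twoStepDiff-suc i = trans (twoStepDiff-suc≡outer i) (regroup (S (i + + 2)) (S i))
    where
    regroup : ∀ a c → a + c ≡ (a - c) + (c + c)
    regroup = solve-∀

  twoStepDiff-≡₂ : ∀ i → twoStepDiff S i ≡₂ twoStepDiff S (+ 0)
  twoStepDiff-≡₂ = ≡₂-constant (twoStepDiff S) λ i →
    mod2 (subst (+ 2 ∣_) (sym (step i)) (2∣x+x (S i)))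
    where
    x+y-x≡y : ∀ x y → x + y - x ≡ y
    x+y-x≡y = solve-∀
    step : ∀ i → twoStepDiff S (i + + 1) - twoStepDiff S i ≡ S i + S i
    step i = trans (cong (_- twoStepDiff S i) (twoStepDiff-suc i))
                   (x+y-x≡y (twoStepDiff S i) (S i + S i))

module _ {S : ℤ → ℤ} (alternating : ∀ k → ¬ S (k + + 2) ≡₂ S k) where

  alternating-period4 : ∀ k → S (k + + 4) ≡₂ S k
  alternating-period4 k = ≢₂-trans
    (subst (λ j → ¬ S j ≡₂ S (k + + 2)) (ℤ.+-assoc k (+ 2) (+ 2)) (alternating (k + + 2)))
    (alternating k)

  alternating-periodic : ∀ k i → S (k + + 4 * i) ≡₂ S k
  alternating-periodic k i = subst (λ j → S (k + + 4 * i) ≡₂ S j) (ℤ.+-identityʳ k)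
    (≡₂-constant (λ i → S (k + + 4 * i)) step i)
    where
    reindex : ∀ k i → k + + 4 * (i + + 1) ≡ k + + 4 * i + + 4
    reindex = solve-∀
    step : ∀ i → S (k + + 4 * (i + + 1)) ≡₂ S (k + + 4 * i)
    step i = subst (λ j → S j ≡₂ S (k + + 4 * i)) (sym (reindex k i)) (alternating-period4 (k + + 4 * i))

  alternating-typeEEOO-from : ∀ j → + 2 ∣ S j → + 2 ∣ S (j + + 1) → TypeEEOO S
  alternating-typeEEOO-from j e₀ e₁ = j , λ i →
      ∣⇒∣ᵤ (even-resp-≡₂ (alternating-periodic j i) e₀)
    , ∣⇒∣ᵤ (even-resp-≡₂ (periodic-at 1 i) e₁)
    , (λ e → odd-resp-≡₂ (periodic-at 2 i) o₂ (∣ᵤ⇒∣ e))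
    , (λ e → odd-resp-≡₂ (periodic-at 3 i) o₃ (∣ᵤ⇒∣ e))
    where
    periodic-at : ∀ n i → S (j + + 4 * i + + n) ≡₂ S (j + + n)
    periodic-at n i = subst (λ m → S m ≡₂ S (j + + n)) (xy∙z≈xz∙y j (+ n) (+ 4 * i))
                            (alternating-periodic (j + + n) i)
    o₂ : ¬ + 2 ∣ S (j + + 2)
    o₂ = ≢₂-even⇒odd (alternating j) e₀
    o₃ : ¬ + 2 ∣ S (j + + 3)
    o₃ = subst (λ m → ¬ + 2 ∣ S m) (ℤ.+-assoc j (+ 1) (+ 2))
               (≢₂-even⇒odd (alternating (j + + 1)) e₁)

  -- The parities of (S k, S (k+1)) cycle through (p, q), (q, ¬p), (¬p, ¬q), (¬q, p),
  -- so one of k = 0, 1, 2, 3 starts a pair of evens.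
  alternating-typeEEOO : TypeEEOO S
  alternating-typeEEOO with + 2 ∣? S (+ 0) | + 2 ∣? S (+ 1)
  ... | yes e₀ | yes e₁ = alternating-typeEEOO-from (+ 0) e₀ e₁
  ... | no o₀  | yes e₁ = alternating-typeEEOO-from (+ 1) e₁ (≢₂-odd⇒even (alternating (+ 0)) o₀)
  ... | no o₀  | no o₁  = alternating-typeEEOO-from (+ 2) (≢₂-odd⇒even (alternating (+ 0)) o₀)
                                                         (≢₂-odd⇒even (alternating (+ 1)) o₁)
  ... | yes e₀ | no o₁  = alternating-typeEEOO-from (+ 3) e₃ (≢₂-odd⇒even (alternating (+ 2)) o₂)
    where
    o₂ : ¬ + 2 ∣ S (+ 2)
    o₂ = ≢₂-even⇒odd (alternating (+ 0)) e₀
    e₃ : + 2 ∣ S (+ 3)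
    e₃ = ≢₂-odd⇒even (alternating (+ 1)) o₁

typeEEOO⇒twoStepDiff-odd : ∀ S → TypeEEOO S → ∃ λ j → ¬ + 2 ∣ twoStepDiff S j
typeEEOO⇒twoStepDiff-odd S (j , eeoo) with eeoo (+ 0)
... | e₀ , _ , o₂ , _ =
  j′ , λ t → o₂ (∣⇒∣ᵤ (even-resp-≡₂ {S (j′ + + 2)} {S j′} (mod2 t) (∣ᵤ⇒∣ e₀)))
  where
  j′ : ℤ
  j′ = j + + 0

twoStepDiff-even⊎typeEEOO : ∀ {S} → TribLike S → (∀ i → + 2 ∣ twoStepDiff S i) ⊎ TypeEEOO S
twoStepDiff-even⊎typeEEOO {S} tr with + 2 ∣? twoStepDiff S (+ 0)
... | yes e = inj₁ λ i → even-resp-≡₂ (twoStepDiff-≡₂ tr i) e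
... | no o  = inj₂ (alternating-typeEEOO {S} λ k p →
                      odd-resp-≡₂ (twoStepDiff-≡₂ tr k) o (_≡₂_.2∣x-y p))

hasDifference⇒double≡twoStepDiff : ∀ S Q → TribLikeℚ Q → HasDifference Q S →
                        ∀ i → Q i ℚ.+ Q i ≡ twoStepDiff S i /1
hasDifference⇒double≡twoStepDiff S Q t d i = begin
  Q i ℚ.+ Q i
    ≡⟨ regroup (Q (i + + 2)) (Q (i + + 1)) (Q i) ⟩
  (Q (i + + 2) ℚ.+ Q (i + + 1) ℚ.+ Q i ℚ.- Q (i + + 2)) ℚ.- (Q (i + + 1) ℚ.- Q i)
    ≡⟨ cong (λ q → q ℚ.- Q (i + + 2) ℚ.- (Q (i + + 1) ℚ.- Q i)) (tribonacciBy-forward ℚ._+_ t i) ⟨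
  (Q (i + + 3) ℚ.- Q (i + + 2)) ℚ.- (Q (i + + 1) ℚ.- Q i)
    ≡⟨ cong (λ j → (Q j ℚ.- Q (i + + 2)) ℚ.- (Q (i + + 1) ℚ.- Q i)) (ℤ.+-assoc i (+ 2) (+ 1)) ⟨
  (Q (i + + 2 + + 1) ℚ.- Q (i + + 2)) ℚ.- (Q (i + + 1) ℚ.- Q i)
    ≡⟨ cong₂ ℚ._-_ (d (i + + 2)) (d i) ⟩
  S (i + + 2) /1 ℚ.- S i /1
    ≡⟨ /1-minus (S (i + + 2)) (S i) ⟨
  twoStepDiff S i /1
    ∎
  where
  open ℚSolver.+-*-Solver
  regroup : ∀ a b c → c ℚ.+ c ≡ (a ℚ.+ b ℚ.+ c ℚ.- a) ℚ.- (b ℚ.- c)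
  regroup = solve 3 (λ a b c → c :+ c := (a :+ b :+ c :- a) :- (b :- c)) refl

hasDifference-unique : ∀ S Q → TribLikeℚ Q → HasDifference Q S →
                        ∀ Q′ → TribLikeℚ Q′ → HasDifference Q′ S → ∀ i → Q′ i ≡ Q i
hasDifference-unique S Q t d Q′ t′ d′ i =
  p+p≡q+q⇒p≡q (trans (hasDifference⇒double≡twoStepDiff S Q′ t′ d′ i) (sym (hasDifference⇒double≡twoStepDiff S Q t d i)))

hasDifference-integral⇒twoStepDiff-even : ∀ S Q (X : ℤ → ℤ) → TribLikeℚ Q → HasDifference Q S →
                                          (∀ i → Q i ≡ X i /1) → ∀ i → + 2 ∣ twoStepDiff S i
hasDifference-integral⇒twoStepDiff-even S Q X t d Q≡X i = subst (+ 2 ∣_) (sym T≡X+X) (2∣x+x (X i))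
  where
  T≡X+X : twoStepDiff S i ≡ X i + X i
  T≡X+X = /1-injective (begin
    twoStepDiff S i /1   ≡⟨ hasDifference⇒double≡twoStepDiff S Q t d i ⟨
    Q i ℚ.+ Q i          ≡⟨ cong₂ ℚ._+_ (Q≡X i) (Q≡X i) ⟩
    X i /1 ℚ.+ X i /1    ≡⟨ /1-+ (X i) (X i) ⟨
    (X i + X i) /1       ∎)

halve : ℤ → ℚ
halve x = ½ ℚ.* (x /1)

halve-+ : ∀ x y → halve (x + y) ≡ halve x ℚ.+ halve y
halve-+ x y = trans (cong (½ ℚ.*_) (/1-+ x y)) (ℚ.*-distribˡ-+ ½ (x /1) (y /1))

halve-double : ∀ x → halve (x + x) ≡ x /1
halve-double x = trans (cong (½ ℚ.*_) (/1-+ x x)) (½*[p+p]≡p (x /1))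

antidifference : (ℤ → ℤ) → ℤ → ℚ
antidifference S = halve ∘ twoStepDiff S

module _ {S : ℤ → ℤ} (tr : TribLike S) where

  antidifference-tribLikeℚ : TribLikeℚ (antidifference S)
  antidifference-tribLikeℚ = tribonacciBy-map _+_ ℚ._+_ halve halve-+ (twoStepDiff-tribLike tr)

  antidifference-hasDifference : HasDifference (antidifference S) S
  antidifference-hasDifference i = begin
    halve (twoStepDiff S (i + + 1)) ℚ.- halve t
      ≡⟨ cong (λ x → halve x ℚ.- halve t) (twoStepDiff-suc tr i) ⟩
    halve (t + (S i + S i)) ℚ.- halve t
      ≡⟨ cong (ℚ._- halve t) (halve-+ t (S i + S i)) ⟩
    (halve t ℚ.+ halve (S i + S i)) ℚ.- halve t
      ≡⟨ cancel (halve t) (halve (S i + S i)) ⟩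
    halve (S i + S i)
      ≡⟨ halve-double (S i) ⟩
    S i /1
      ∎
    where
    t : ℤ
    t = twoStepDiff S i
    open ℚSolver.+-*-Solver
    cancel : ∀ a b → (a ℚ.+ b) ℚ.- a ≡ b
    cancel = solve 2 (λ a b → (a :+ b) :- a := b) refl

twoStepDiff-eventuallyPositive : ∀ {S} → ExtraTrib S → EventuallyPositive (twoStepDiff S)
twoStepDiff-eventuallyPositive {S} (tr , N , pos) = N + + 1 , λ i N+1≤i →
  subst (λ j → + 0 < twoStepDiff S j) (x-y+y≡x i (+ 1))
    (subst (+ 0 <_) (sym (twoStepDiff-suc≡outer tr (i - + 1)))
      (ℤ.+-mono-< (pos (i - + 1 + + 2) (ℤ.≤-trans (N≤i-1 N+1≤i) (ℤ.i≤i+j (i - + 1) (+ 2))))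
                  (pos (i - + 1) (N≤i-1 N+1≤i))))
  where
  n+1-1≡n : ∀ n → n + + 1 - + 1 ≡ n
  n+1-1≡n = solve-∀
  N≤i-1 : ∀ {i} → N + + 1 ≤ i → N ≤ i - + 1
  N≤i-1 {i} N+1≤i = subst (_≤ i - + 1) (n+1-1≡n N) (ℤ.+-monoˡ-≤ (- + 1) N+1≤i)

antidifference-extraTribℚ : ∀ {S} → ExtraTrib S → (∀ i → + 2 ∣ twoStepDiff S i) →
                            ExtraTribℚ (antidifference S)
antidifference-extraTribℚ {S} extra@(tr , _) even = X , Q≡X , X-tribLike , X-positive
  where
  X : ℤ → ℤ
  X i = _∣_.quotient (even i)
  T≡X*2 : ∀ i → twoStepDiff S i ≡ X i * + 2
  T≡X*2 i = _∣_.equality (even i)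
  x*2≡x+x : ∀ x → x * + 2 ≡ x + x
  x*2≡x+x = solve-∀
  Q≡X : ∀ i → antidifference S i ≡ X i /1
  Q≡X i = trans (cong halve (trans (T≡X*2 i) (x*2≡x+x (X i)))) (halve-double (X i))
  X-tribLike : TribLike X
  X-tribLike = tribonacciBy-reflect _+_ ℚ._+_ _/1 /1-injective /1-+ (sym ∘ Q≡X)
                                    (antidifference-tribLikeℚ tr)
  X-positive : EventuallyPositive X
  X-positive with twoStepDiff-eventuallyPositive extra
  ... | N , T>0 = N , λ i N≤i → ℤ.*-cancelʳ-<-nonNeg (+ 2) (subst (+ 0 <_) (T≡X*2 i) (T>0 i N≤i))

mainTheorem8 : (S : ℤ → ℤ) → ExtraTrib S →
    ∃ λ (Q : ℤ → ℚ) →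
      (TribLikeℚ Q × HasDifference Q S)
      × (∀ (Q′ : ℤ → ℚ) → TribLikeℚ Q′ → HasDifference Q′ S → ∀ i → Q′ i ≡ Q i)
      × (ExtraTribℚ Q ⇔ (¬ TypeEEOO S))
mainTheorem8 S extra@(tr , _) =
  Q , (Q-tribLike , Q-difference) , hasDifference-unique S Q Q-tribLike Q-difference ,
  mk⇔ integral⇒¬typeEEOO ¬typeEEOO⇒integral
  where
  Q : ℤ → ℚ
  Q = antidifference S
  Q-tribLike : TribLikeℚ Q
  Q-tribLike = antidifference-tribLikeℚ tr
  Q-difference : HasDifference Q S
  Q-difference = antidifference-hasDifference tr

  integral⇒¬typeEEOO : ExtraTribℚ Q → ¬ TypeEEOO S
  integral⇒¬typeEEOO (X , Q≡X , _) eeoo with typeEEOO⇒twoStepDiff-odd S eeoo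
  ... | j , odd = odd (hasDifference-integral⇒twoStepDiff-even S Q X Q-tribLike Q-difference Q≡X j)

  ¬typeEEOO⇒integral : ¬ TypeEEOO S → ExtraTribℚ Q
  ¬typeEEOO⇒integral ¬eeoo with twoStepDiff-even⊎typeEEOO tr
  ... | inj₁ even = antidifference-extraTribℚ extra even
  ... | inj₂ eeoo = ⊥-elim (¬eeoo eeoo)
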